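{- Let $t\ge 2$ be an integer and let $K_t/e$ denote the graph obtained from the complete graph $K_t$ by deleting one edge. If $\Gamma$ is a finite simple graph with $A(\Gamma;x)=A(K_t/e;x)$, then $\Gamma$ is isomorphic to $K_t/e$.
   Context: All graphs are finite and simple with at least one vertex. For a graph $\Gamma=(V,E)$ of order $n$, a vertex $v$ and $X\subseteq V$, let $\delta_X(v)$ be the number of neighbours of $v$ in $X$, $\delta_1$ the maximum degree, and $\bar S=V\setminus S$. Let $\mathcal{K}=[-\delta_1,\delta_1]\cap\mathbb{Z}$. A nonempty $S\subseteq V$ is a defensive $k$-alliance if $\delta_S(v)\ge\delta_{\bar S}(v)+k$ for all $v\in S$. The exact index of alliance of a nonempty $S$ is $k_S=\max\{k\in\mathcal{K}: S \text{ is a defensive } k\text{ -alliance}\}$ (equivalently $k_S=\min_{v\in S}(\delta_S(v)-\delta_{\bar S}(v))$). The alliance polynomial is $A(\Gamma;x)=\sum_{S} x^{n+k_S}$, the sum over all nonempty $S\subseteq V$ whose induced subgraph $\langle S\rangle$ is connected. -}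

module Defs where

open import Data.Bool using (Bool; true; false; _∧_; _∨_; not; if_then_else_)
open import Data.Nat using (ℕ; zero; suc; _≤_; _≡ᵇ_; s≤s; z≤n)
open import Data.Integer using (ℤ; +_; _-_; _⊓_; _+_)
open import Data.Fin using (Fin; toℕ; _≟_)
open import Data.List using (List; []; _∷_; map; filter; length; foldr; _++_; allFin)
open import Data.Maybe using (Maybe; just; nothing)
open import Data.Product using (Σ)
open import Data.Vec using (Vec; []; _∷_; lookup)
open import Relation.Nullary.Decidable using (⌊_⌋)
open import Relation.Binary.PropositionalEquality using (_≡_; refl; cong) renaming (sym to ≡-sym)
open import Relation.Nullary using (yes; no)
open import Data.Empty using (⊥-elim)
open import Data.Bool.Properties using (∨-comm)
open import Data.Nat.Properties using (≤-trans)
open import Function.Bundles using (_⤖_; Bijection)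

record Graph : Set where
  field
    order  : ℕ
    nonempty : 1 ≤ order
    adj    : Fin order → Fin order → Bool
    sym    : ∀ u v → adj u v ≡ adj v u
    irrefl : ∀ u → adj u u ≡ false
open Graph public

VSet : ℕ → Set
VSet n = Vec Bool n

_∈ᵇ_ : ∀ {n} → Fin n → VSet n → Bool
v ∈ᵇ S = lookup S v

complement : ∀ {n} → VSet n → VSet n
complement = Data.Vec.map not

allSubsets : (n : ℕ) → List (VSet n)
allSubsets zero = [] ∷ []
allSubsets (suc n) = map (true ∷_) (allSubsets n) ++ map (false ∷_) (allSubsets n)

anyᵇ : ∀ {n} → (Fin n → Bool) → Bool
anyᵇ {n} p = foldr (λ v b → p v ∨ b) false (allFin n)

allᵇ : ∀ {n} → (Fin n → Bool) → Bool
allᵇ {n} p = foldr (λ v b → p v ∧ b) true (allFin n)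

countᵇ : ∀ {n} → (Fin n → Bool) → ℕ
countᵇ {n} p = length (filter (λ v → Data.Bool._≟_ (p v) true) (allFin n))

δ : (Γ : Graph) → VSet (order Γ) → Fin (order Γ) → ℕ
δ Γ X v = countᵇ (λ w → adj Γ v w ∧ (w ∈ᵇ X))

-- reachᵏ Γ S k u v : there is a walk from u to v of length ≤ k all of whose
-- vertices lie in S (u itself assumed in S by the caller)
reach : (Γ : Graph) → VSet (order Γ) → ℕ → Fin (order Γ) → Fin (order Γ) → Bool
reach Γ S zero u v = ⌊ u ≟ v ⌋
reach Γ S (suc k) u v =
  reach Γ S k u v ∨ anyᵇ (λ w → reach Γ S k u w ∧ adj Γ w v ∧ (v ∈ᵇ S))

nonemptyᵇ : ∀ {n} → VSet n → Bool
nonemptyᵇ S = anyᵇ (λ v → v ∈ᵇ S)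

connectedᵇ : (Γ : Graph) → VSet (order Γ) → Bool
connectedᵇ Γ S = nonemptyᵇ S ∧
  allᵇ (λ u → allᵇ (λ v → not (u ∈ᵇ S ∧ v ∈ᵇ S) ∨ reach Γ S (order Γ) u v))

margin : (Γ : Graph) → VSet (order Γ) → Fin (order Γ) → ℤ
margin Γ S v = + δ Γ S v - + δ Γ (complement S) v

-- exact index of alliance k_S = min_{v ∈ S} (δ_S(v) - δ_{S̄}(v)), for nonempty S.
-- (The fold starts from the value at an element of S; for empty S the
-- value is irrelevant since such S are never counted.)
minOver : ∀ {n} → VSet n → (Fin n → ℤ) → List (Fin n) → Maybe ℤ
minOver S f [] = nothing
minOver S f (v ∷ vs) with v ∈ᵇ S | minOver S f vs
... | false | m = m
... | true  | nothing = just (f v)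
... | true  | just m  = just (f v ⊓ m)

kS : (Γ : Graph) → VSet (order Γ) → ℤ
kS Γ S with minOver S (margin Γ S) (allFin (order Γ))
... | just k  = k
... | nothing = + 0

-- coefficient of x^j in the alliance polynomial A(Γ;x) = Σ_S x^{n + k_S},
-- S ranging over nonempty vertex sets with ⟨S⟩ connected.
allianceCoeff : Graph → ℤ → ℕ
allianceCoeff Γ j = length (filter
  (λ S → Data.Bool._≟_ (connectedᵇ Γ S ∧ ⌊ Data.Integer._≟_ (+ order Γ + kS Γ S) j ⌋) true)
  (allSubsets (order Γ)))

SameAlliancePoly : Graph → Graph → Set
SameAlliancePoly Γ Δ = ∀ (j : ℤ) → allianceCoeff Γ j ≡ allianceCoeff Δ j

_≅_ : Graph → Graph → Set
Γ ≅ Δ = Σ (Fin (order Γ) ⤖ Fin (order Δ)) λ f →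
  ∀ u v → adj Δ (Bijection.to f u) (Bijection.to f v) ≡ adj Γ u v

-- K_t / e : complete graph on Fin t with the edge {0,1} deleted
-- isE01 a b = true iff {a,b} = {0,1}
isE01 : ℕ → ℕ → Bool
isE01 0 1 = true
isE01 1 0 = true
isE01 _ _ = false

isE01-sym : ∀ a b → isE01 a b ≡ isE01 b a
isE01-sym 0 0 = refl
isE01-sym 0 1 = refl
isE01-sym 0 (suc (suc b)) = refl
isE01-sym 1 0 = refl
isE01-sym 1 1 = refl
isE01-sym 1 (suc (suc b)) = refl
isE01-sym (suc (suc a)) 0 = refl
isE01-sym (suc (suc a)) 1 = refl
isE01-sym (suc (suc a)) (suc (suc b)) = refl

Kminus-adj : (t : ℕ) → Fin t → Fin t → Bool
Kminus-adj t u v = not ⌊ u ≟ v ⌋ ∧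
  not (isE01 (toℕ u) (toℕ v))

Kminus-irrefl : ∀ t (u : Fin t) → Kminus-adj t u u ≡ false
Kminus-irrefl t u with u ≟ u
... | yes _ = refl
... | no u≢u = ⊥-elim (u≢u refl)

Kminus-sym : ∀ t (u v : Fin t) → Kminus-adj t u v ≡ Kminus-adj t v u
Kminus-sym t u v with u ≟ v | v ≟ u
... | yes _ | yes _ = refl
... | no _ | no _ = cong not (isE01-sym (toℕ u) (toℕ v))
... | yes p | no q = ⊥-elim (q (≡-sym p))
... | no p | yes q = ⊥-elim (p (≡-sym q))

Kminus : (t : ℕ) → 2 ≤ t → Graph
Kminus t 2≤t = record
  { order = t
  ; nonempty = ≤-trans (s≤s z≤n) 2≤t
  ; adj = Kminus-adj t
  ; sym = Kminus-sym t
  ; irrefl = Kminus-irrefl t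
  }

module Submission where

-- Write C(Γ) and D(Γ) for the numbers of vertex sets S ⊆ V that do / do not
-- induce a connected subgraph (∅ counts as not connected), so C + D = 2^n.
-- Every exponent n + k_S lies in [0, 2n], hence A(Γ; 1) = C(Γ), and
-- C(K_t/e) = 2^t − 2 because ∅ and {0, 1} are the only non-connected sets.
-- So C(Γ) = 2^t − 2, and the order n of Γ is pinned down:
--   * t ≤ n, as D(Γ) ≥ 1 gives 2^t ≤ 2^n + 1;
--   * n ≤ t: for t = 2 the n singletons are connected; for t ≥ 3 the
--     coefficient of x¹ is positive, and a set of exponent 1 forces a universal
--     vertex w, whose 2^(n−1) supersets are all connected.
-- With n = t we get D(Γ) = 2: Γ misses some edge {a, b} (otherwise D = 1) and no
-- other (else ∅, {a, b}, {c, d} are three non-connected sets), and a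
-- permutation sending a, b to 0, 1 is an isomorphism onto K_t/e.

open import Defs hiding (sym)
open import Data.Nat using (ℕ; _≤_)
import Data.Nat as ℕ

open import Algebra.Properties.CommutativeSemigroup using (interchange)
open import Data.Bool using (Bool; true; false; _∧_; _∨_; not)
import Data.Bool as Bool
open import Data.Bool.Properties using (∧-zeroʳ; not-involutive)
open import Data.Empty using (⊥-elim)
open import Data.Fin using (Fin; zero; suc; _≟_; toℕ)
open import Data.Fin.Permutation using (Permutation′; transpose; _∘ₚ_; _⟨$⟩ʳ_; _⟨$⟩ˡ_; inverseˡ)
import Data.Fin.Permutation.Components as PC
open import Data.Fin.Properties using (suc-injective; any?; toℕ-injective)
open import Data.Integer using (ℤ; +_; _-_)
import Data.Integer as ℤ
import Data.Integer.Properties as ℤ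
open import Data.Integer.Tactic.RingSolver using (solve-∀)
open import Data.List using (List; []; _∷_; map; filter; length; foldr; _++_; allFin)
import Data.List as List
open import Data.List.Membership.Propositional using (_∈_)
open import Data.List.Membership.Propositional.Properties using (∈-allFin)
import Data.List.Properties as ListP
open import Data.List.Relation.Unary.Any using (here; there)
open import Data.Maybe using (Maybe; just; nothing)
open import Data.Nat using (zero; suc; _+_; _∸_; _^_; _<_; z≤n; s≤s)
open import Data.Nat.Properties
  using (≤-trans; ≤-reflexive; m≤n+m; m≤m+n; +-comm; +-identityʳ; +-commutativeSemigroup; +-mono-≤;
         +-monoʳ-≤; m≤n⇒∃[o]m+o≡n; m∸n≤m; m+n∸m≡n; ∸-monoˡ-≤; ≤-antisym; ≤-refl;
         m≤n⇒m≤1+n; 1+n≰n; ≤-pred; ≤∧≢⇒<; <⇒≱; ≮⇒≥; ^-monoʳ-≤; +-suc; +-monoʳ-<;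
         +-mono-<-≤; m<m+n; +-cancelʳ-≡; +-cancelˡ-≡; module ≤-Reasoning)
open import Data.Product using (Σ; ∃; _×_; _,_)
open import Data.Sum using (_⊎_; inj₁; inj₂)
open import Data.Vec using ([]; _∷_; lookup; replicate; tabulate)
open import Data.Vec.Properties using (lookup-replicate; lookup∘tabulate; lookup-map; tabulate∘lookup; tabulate-cong; ≡-dec)
open import Function.Properties.Inverse using (↔⇒⤖)
open import Relation.Binary.PropositionalEquality
open import Relation.Nullary using (¬_; yes; no)
open import Relation.Nullary.Decidable using (Dec; ⌊_⌋; ¬?; _×-dec_; dec-true; dec-false)

-- Counting with boolean tests.

-- Number of list elements passing a boolean test; Defs counts neighbours
-- (δ) and coefficients (allianceCoeff) with exactly this expression.
count : {A : Set} → (A → Bool) → List A → ℕ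
count p L = length (filter (λ x → p x Bool.≟ true) L)

indicator : Bool → ℕ
indicator true  = 1
indicator false = 0

count-cons : ∀ {A : Set} (p : A → Bool) x L → count p (x ∷ L) ≡ indicator (p x) + count p L
count-cons p x L with p x
... | true  = refl
... | false = refl

count-++ : ∀ {A : Set} (p : A → Bool) L M → count p (L ++ M) ≡ count p L + count p M
count-++ p L M = trans (cong length (ListP.filter-++ _ L M)) (ListP.length-++ (filter _ L))

count-map : ∀ {A C : Set} (p : C → Bool) (f : A → C) L → count p (map f L) ≡ count (λ x → p (f x)) L
count-map p f []      = refl
count-map p f (x ∷ L) = begin
  count p (f x ∷ map f L)                       ≡⟨ count-cons p (f x) (map f L) ⟩
  indicator (p (f x)) + count p (map f L)       ≡⟨ cong (_+_ (indicator (p (f x)))) (count-map p f L) ⟩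
  indicator (p (f x)) + count (λ x → p (f x)) L ≡⟨ count-cons (λ x → p (f x)) x L ⟨
  count (λ x → p (f x)) (x ∷ L)                 ∎
  where open ≡-Reasoning

count-none : ∀ {A : Set} (p : A → Bool) L → (∀ x → p x ≡ false) → count p L ≡ 0
count-none p []      h = refl
count-none p (x ∷ L) h rewrite count-cons p x L | h x = count-none p L h

count-split : ∀ {A : Set} (p q : A → Bool) L →
  count p L ≡ count (λ x → p x ∧ q x) L + count (λ x → p x ∧ not (q x)) L
count-split p q []      = refl
count-split p q (x ∷ L)
  rewrite count-cons p x L | count-cons (λ x → p x ∧ q x) x L
        | count-cons (λ x → p x ∧ not (q x)) x L | count-split p q L
  = trans (cong (_+ _) (split (p x) (q x)))
      (interchange +-commutativeSemigroup (indicator (p x ∧ q x)) (indicator (p x ∧ not (q x)))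
        (count (λ x → p x ∧ q x) L) (count (λ x → p x ∧ not (q x)) L))
  where
  split : ∀ a b → indicator a ≡ indicator (a ∧ b) + indicator (a ∧ not b)
  split true  true  = refl
  split true  false = refl
  split false b     = refl

count-mono : ∀ {A : Set} (p q : A → Bool) L → (∀ x → p x ≡ true → q x ≡ true) → count p L ≤ count q L
count-mono p q []      h = z≤n
count-mono p q (x ∷ L) h rewrite count-cons p x L | count-cons q x L with p x in px
... | true rewrite h x px = s≤s (count-mono p q L h)
... | false = ≤-trans (count-mono p q L h) (m≤n+m _ (indicator (q x)))

count-true : ∀ {A : Set} (L : List A) → count (λ _ → true) L ≡ length L
count-true []      = refl
count-true (x ∷ L) = cong suc (count-true L)

count-≤-length : ∀ {A : Set} (p : A → Bool) L → count p L ≤ length L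
count-≤-length p L = ListP.length-filter _ L

count-compl : ∀ {A : Set} (p : A → Bool) L → count p L + count (λ x → not (p x)) L ≡ length L
count-compl p L = trans (sym (count-split (λ _ → true) p L)) (count-true L)

count-≥1 : ∀ {A : Set} (p : A → Bool) {x} L → x ∈ L → p x ≡ true → 1 ≤ count p L
count-≥1 p (y ∷ L) (here refl) e rewrite count-cons p y L | e = s≤s z≤n
count-≥1 p (y ∷ L) (there m)   e rewrite count-cons p y L =
  ≤-trans (count-≥1 p L m e) (m≤n+m _ (indicator (p y)))

count-≥2 : ∀ {A : Set} (p : A → Bool) {x y} L → x ∈ L → y ∈ L → ¬ x ≡ y →
  p x ≡ true → p y ≡ true → 2 ≤ count p L
count-≥2 p (z ∷ L) (here refl) (here refl) x≢y px py = ⊥-elim (x≢y refl)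
count-≥2 p (z ∷ L) (here refl) (there my)  x≢y px py rewrite count-cons p z L | px =
  s≤s (count-≥1 p L my py)
count-≥2 p (z ∷ L) (there mx)  (here refl) x≢y px py rewrite count-cons p z L | py =
  s≤s (count-≥1 p L mx px)
count-≥2 p (z ∷ L) (there mx)  (there my)  x≢y px py rewrite count-cons p z L =
  ≤-trans (count-≥2 p L mx my x≢y px py) (m≤n+m _ (indicator (p z)))

count-allFin-suc : ∀ {n} (p : Fin (suc n) → Bool) →
  count p (allFin (suc n)) ≡ indicator (p zero) + count (λ x → p (suc x)) (allFin n)
count-allFin-suc {n} p = begin
  count p (zero ∷ List.tabulate suc)          ≡⟨ count-cons p zero (List.tabulate suc) ⟩
  indicator (p zero) + count p (List.tabulate suc)
    ≡⟨ cong (λ L → indicator (p zero) + count p L) (ListP.map-tabulate (λ x → x) suc) ⟨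
  indicator (p zero) + count p (map suc (allFin n)) ≡⟨ cong (_+_ (indicator (p zero))) (count-map p suc (allFin n)) ⟩
  indicator (p zero) + count (λ x → p (suc x)) (allFin n) ∎
  where open ≡-Reasoning

count-allFin-≤1 : ∀ {n} (p : Fin n → Bool) → (∀ x y → p x ≡ true → p y ≡ true → x ≡ y) →
  count p (allFin n) ≤ 1
count-allFin-≤1 {zero}  p unique = z≤n
count-allFin-≤1 {suc n} p unique rewrite count-allFin-suc p with p zero in p0
... | true  = ≤-reflexive (cong suc (count-none (λ x → p (suc x)) (allFin n) rest))
  where
  rest : ∀ x → p (suc x) ≡ false
  rest x with p (suc x) in px
  ... | false = refl
  ... | true with unique (suc x) zero px p0
  ... | ()
... | false = count-allFin-≤1 (λ x → p (suc x)) (λ x y px py → suc-injective (unique (suc x) (suc y) px py))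

count-witness : ∀ {A : Set} (p : A → Bool) L → 1 ≤ count p L → ∃ λ x → p x ≡ true
count-witness p (x ∷ L) h with p x in px
... | true  = x , px
... | false = count-witness p L h

∧-intro : ∀ {a b} → a ≡ true → b ≡ true → a ∧ b ≡ true
∧-intro refl refl = refl

∧-elimˡ : ∀ a {b} → a ∧ b ≡ true → a ≡ true
∧-elimˡ true e = refl

∧-elimʳ : ∀ a {b} → a ∧ b ≡ true → b ≡ true
∧-elimʳ true e = e

∨-introˡ : ∀ {a} b → a ≡ true → a ∨ b ≡ true
∨-introˡ b refl = refl

∨-introʳ : ∀ a {b} → b ≡ true → a ∨ b ≡ true
∨-introʳ true  e = refl
∨-introʳ false e = e

∨-elim : ∀ a {b} → a ∨ b ≡ true → a ≡ true ⊎ b ≡ true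
∨-elim true  e = inj₁ refl
∨-elim false e = inj₂ e

false≢true : ¬ false ≡ true
false≢true ()

⌊⌋-true : ∀ {A : Set} (d : Dec A) → A → ⌊ d ⌋ ≡ true
⌊⌋-true (yes _) a = refl
⌊⌋-true (no ¬a) a = ⊥-elim (¬a a)

⌊⌋-false : ∀ {A : Set} (d : Dec A) → ¬ A → ⌊ d ⌋ ≡ false
⌊⌋-false (yes a) ¬a = ⊥-elim (¬a a)
⌊⌋-false (no _)  ¬a = refl

⌊⌋-sound : ∀ {A : Set} (d : Dec A) → ⌊ d ⌋ ≡ true → A
⌊⌋-sound (yes a) _ = a

any-intro : ∀ {n} (p : Fin n → Bool) w → p w ≡ true → anyᵇ p ≡ true
any-intro {n} p w = go (allFin n) (∈-allFin w)
  where
  go : ∀ L → w ∈ L → p w ≡ true → foldr (λ v b → p v ∨ b) false L ≡ true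
  go (x ∷ L) (here refl) e = ∨-introˡ _ e
  go (x ∷ L) (there m)   e = ∨-introʳ (p x) (go L m e)

any-elim : ∀ {n} (p : Fin n → Bool) → anyᵇ p ≡ true → ∃ λ w → p w ≡ true
any-elim {n} p = go (allFin n)
  where
  go : ∀ L → foldr (λ v b → p v ∨ b) false L ≡ true → ∃ λ w → p w ≡ true
  go (x ∷ L) e with ∨-elim (p x) e
  ... | inj₁ px = x , px
  ... | inj₂ e′ = go L e′

all-intro : ∀ {n} (p : Fin n → Bool) → (∀ w → p w ≡ true) → allᵇ p ≡ true
all-intro {n} p h = go (allFin n)
  where
  go : ∀ L → foldr (λ v b → p v ∧ b) true L ≡ true
  go []      = refl
  go (x ∷ L) = ∧-intro (h x) (go L)

all-elim : ∀ {n} (p : Fin n → Bool) → allᵇ p ≡ true → ∀ w → p w ≡ true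
all-elim {n} p e w = go (allFin n) e (∈-allFin w)
  where
  go : ∀ L → foldr (λ v b → p v ∧ b) true L ≡ true → w ∈ L → p w ≡ true
  go (x ∷ L) e (here refl) = ∧-elimˡ (p x) e
  go (x ∷ L) e (there m)   = go L (∧-elimʳ (p x) e) m

countSets : ∀ {n} → (VSet n → Bool) → ℕ
countSets {n} P = count P (allSubsets n)

countSets-suc : ∀ {n} (P : VSet (suc n) → Bool) →
  countSets P ≡ countSets (λ S → P (true ∷ S)) + countSets (λ S → P (false ∷ S))
countSets-suc {n} P = trans (count-++ P (map (true ∷_) (allSubsets n)) (map (false ∷_) (allSubsets n)))
  (cong₂ _+_ (count-map P (true ∷_) (allSubsets n)) (count-map P (false ∷_) (allSubsets n)))

countSets-none : ∀ {n} (P : VSet n → Bool) → (∀ S → P S ≡ false) → countSets P ≡ 0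
countSets-none {n} P = count-none P (allSubsets n)

countSets-all : ∀ n → countSets {n} (λ _ → true) ≡ 2 ^ n
countSets-all zero    = refl
countSets-all (suc n) = begin
  countSets {suc n} (λ _ → true)                          ≡⟨ countSets-suc {n} (λ _ → true) ⟩
  countSets {n} (λ _ → true) + countSets {n} (λ _ → true) ≡⟨ cong₂ _+_ (countSets-all n) (countSets-all n) ⟩
  2 ^ n + 2 ^ n                                           ≡⟨ cong (_+_ (2 ^ n)) (+-identityʳ (2 ^ n)) ⟨
  2 ^ suc n                                               ∎
  where open ≡-Reasoning

countSets-compl : ∀ {n} (P : VSet n → Bool) → countSets P + countSets (λ S → not (P S)) ≡ 2 ^ n
countSets-compl {n} P = begin
  countSets P + countSets (λ S → not (P S))   ≡⟨ count-compl P (allSubsets n) ⟩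
  length (allSubsets n)                       ≡⟨ count-true (allSubsets n) ⟨
  countSets {n} (λ _ → true)                  ≡⟨ countSets-all n ⟩
  2 ^ n                                       ∎
  where open ≡-Reasoning

_=ˢ_ : ∀ {n} → VSet n → VSet n → Bool
[]          =ˢ []          = true
(true ∷ S)  =ˢ (true ∷ T)  = S =ˢ T
(false ∷ S) =ˢ (false ∷ T) = S =ˢ T
(_ ∷ _)     =ˢ (_ ∷ _)     = false

=ˢ-refl : ∀ {n} (S : VSet n) → (S =ˢ S) ≡ true
=ˢ-refl []          = refl
=ˢ-refl (true ∷ S)  = =ˢ-refl S
=ˢ-refl (false ∷ S) = =ˢ-refl S

=ˢ-sound : ∀ {n} (S T : VSet n) → (S =ˢ T) ≡ true → S ≡ T
=ˢ-sound []          []          e = refl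
=ˢ-sound (true ∷ S)  (true ∷ T)  e = cong (true ∷_) (=ˢ-sound S T e)
=ˢ-sound (false ∷ S) (false ∷ T) e = cong (false ∷_) (=ˢ-sound S T e)

countSets-only : ∀ {n} (P : VSet n → Bool) (X : VSet n) → P X ≡ true →
  countSets (λ S → P S ∧ (S =ˢ X)) ≡ 1
countSets-only {zero}  P []          e rewrite e = refl
countSets-only {suc n} P (true ∷ X)  e = trans (countSets-suc (λ S → P S ∧ (S =ˢ (true ∷ X))))
  (cong₂ _+_ (countSets-only (λ S → P (true ∷ S)) X e)
             (countSets-none (λ S → P (false ∷ S) ∧ false) (λ S → ∧-zeroʳ (P (false ∷ S)))))
countSets-only {suc n} P (false ∷ X) e = trans (countSets-suc (λ S → P S ∧ (S =ˢ (false ∷ X))))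
  (cong₂ _+_ (countSets-none (λ S → P (true ∷ S) ∧ false) (λ S → ∧-zeroʳ (P (true ∷ S))))
             (countSets-only (λ S → P (false ∷ S)) X e))

countSets-remove : ∀ {n} (P : VSet n → Bool) (X : VSet n) → P X ≡ true →
  countSets P ≡ suc (countSets (λ S → P S ∧ not (S =ˢ X)))
countSets-remove {n} P X e =
  trans (count-split P (λ S → S =ˢ X) (allSubsets n))
        (cong (_+ countSets (λ S → P S ∧ not (S =ˢ X))) (countSets-only P X e))

countSets-≥1 : ∀ {n} (P : VSet n → Bool) X → P X ≡ true → 1 ≤ countSets P
countSets-≥1 P X e rewrite countSets-remove P X e = s≤s z≤n

countSets-≥3 : ∀ {n} (P : VSet n → Bool) X Y Z → P X ≡ true → P Y ≡ true → P Z ≡ true →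
  (Y =ˢ X) ≡ false → (Z =ˢ X) ≡ false → (Z =ˢ Y) ≡ false → 3 ≤ countSets P
countSets-≥3 P X Y Z pX pY pZ Y≢X Z≢X Z≢Y
  rewrite countSets-remove P X pX
        | countSets-remove (λ S → P S ∧ not (S =ˢ X)) Y (cong₂ (λ p q → p ∧ not q) pY Y≢X)
  = s≤s (s≤s (countSets-≥1 _ Z (cong₂ (λ p q → p ∧ not q) (cong₂ (λ p q → p ∧ not q) pZ Z≢X) Z≢Y)))

countSets-member : ∀ {m} (v : Fin (suc m)) → countSets (λ S → lookup S v) ≡ 2 ^ m
countSets-member {m} zero = begin
  countSets {suc m} (λ S → lookup S zero)             ≡⟨ countSets-suc {m} (λ S → lookup S zero) ⟩
  countSets {m} (λ _ → true) + countSets {m} (λ _ → false)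
    ≡⟨ cong₂ _+_ (countSets-all m) (countSets-none {m} (λ _ → false) (λ _ → refl)) ⟩
  2 ^ m + 0                                           ≡⟨ +-identityʳ (2 ^ m) ⟩
  2 ^ m                                               ∎
  where open ≡-Reasoning
countSets-member {suc m} (suc v) = begin
  countSets {suc (suc m)} (λ S → lookup S (suc v))   ≡⟨ countSets-suc {suc m} (λ S → lookup S (suc v)) ⟩
  countSets (λ S → lookup S v) + countSets (λ S → lookup S v)
    ≡⟨ cong₂ _+_ (countSets-member v) (countSets-member v) ⟩
  2 ^ m + 2 ^ m                                       ≡⟨ cong (_+_ (2 ^ m)) (+-identityʳ (2 ^ m)) ⟨
  2 ^ suc m                                           ∎
  where open ≡-Reasoning

∅ : ∀ {n} → VSet n
∅ {n} = replicate n false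

∉∅ : ∀ {n} (v : Fin n) → ¬ lookup ∅ v ≡ true
∉∅ v e = false≢true (trans (sym (lookup-replicate v false)) e)

nonempty-member : ∀ {n} (S : VSet n) → ¬ S ≡ ∅ → ∃ λ v → lookup S v ≡ true
nonempty-member []          S≢∅ = ⊥-elim (S≢∅ refl)
nonempty-member (true ∷ S)  S≢∅ = zero , refl
nonempty-member (false ∷ S) S≢∅ with nonempty-member S (λ e → S≢∅ (cong (false ∷_) e))
... | v , e = suc v , e

singleton : ∀ {n} → Fin n → VSet n
singleton {suc n} zero    = true ∷ ∅
singleton {suc n} (suc i) = false ∷ singleton i

singleton-self : ∀ {n} (v : Fin n) → lookup (singleton v) v ≡ true
singleton-self zero    = refl
singleton-self (suc v) = singleton-self v

singleton-member : ∀ {n} (v u : Fin n) → lookup (singleton v) u ≡ true → u ≡ v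
singleton-member zero    zero    e = refl
singleton-member zero    (suc u) e = ⊥-elim (∉∅ u e)
singleton-member (suc v) (suc u) e = cong suc (singleton-member v u e)

countSets-singletons : ∀ {n} (P : VSet n → Bool) → (∀ v → P (singleton v) ≡ true) → n ≤ countSets P
countSets-singletons {zero}  P h = z≤n
countSets-singletons {suc n} P h rewrite countSets-suc P =
  +-mono-≤ (countSets-≥1 (λ S → P (true ∷ S)) ∅ (h zero))
           (countSets-singletons (λ S → P (false ∷ S)) (λ v → h (suc v)))

distinct⇒2≤ : ∀ {n} (u v : Fin n) → ¬ u ≡ v → 2 ≤ n
distinct⇒2≤ {suc zero}    zero zero u≢v = ⊥-elim (u≢v refl)
distinct⇒2≤ {suc (suc n)} u    v    u≢v = s≤s (s≤s z≤n)

-- Connectivity of induced subgraphs, through the bounded walks `reach` of Defs.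

module _ (Γ : Graph) where

  Universal : Fin (order Γ) → Set
  Universal w = ∀ x → ¬ w ≡ x → adj Γ w x ≡ true

  reach-refl : ∀ S u → reach Γ S 0 u u ≡ true
  reach-refl S u = ⌊⌋-true (u ≟ u) refl

  reach-step : ∀ S k u w v → reach Γ S k u w ≡ true → adj Γ w v ≡ true → lookup S v ≡ true →
    reach Γ S (suc k) u v ≡ true
  reach-step S k u w v r a v∈S = ∨-introʳ (reach Γ S k u v)
    (any-intro (λ w → reach Γ S k u w ∧ adj Γ w v ∧ (v ∈ᵇ S)) w (∧-intro r (∧-intro a v∈S)))

  reach-mono : ∀ S {k} k′ u v → k ≤ k′ → reach Γ S k u v ≡ true → reach Γ S k′ u v ≡ true
  reach-mono S {k} k′ u v k≤k′ r with m≤n⇒∃[o]m+o≡n k≤k′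
  ... | o , refl rewrite +-comm k o = go o
    where
    go : ∀ o → reach Γ S (o + k) u v ≡ true
    go zero    = r
    go (suc o) = ∨-introˡ _ (go o)

  reach-self : ∀ S u → reach Γ S (order Γ) u u ≡ true
  reach-self S u = reach-mono S (order Γ) u u z≤n (reach-refl S u)

  reach-edge : ∀ S u v → adj Γ u v ≡ true → lookup S v ≡ true → reach Γ S (order Γ) u v ≡ true
  reach-edge S u v uv v∈S = reach-mono S (order Γ) u v (nonempty Γ) (reach-step S 0 u u v (reach-refl S u) uv v∈S)

  connected-intro : ∀ S → (∃ λ v → lookup S v ≡ true) →
    (∀ u v → lookup S u ≡ true → lookup S v ≡ true → reach Γ S (order Γ) u v ≡ true) →
    connectedᵇ Γ S ≡ true
  connected-intro S (w , w∈S) h = ∧-intro (any-intro (λ v → v ∈ᵇ S) w w∈S)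
    (all-intro _ (λ u → all-intro _ (λ v → pair u v)))
    where
    pair : ∀ u v → not (u ∈ᵇ S ∧ v ∈ᵇ S) ∨ reach Γ S (order Γ) u v ≡ true
    pair u v with lookup S u in u∈S | lookup S v in v∈S
    ... | true  | true  = h u v u∈S v∈S
    ... | true  | false = refl
    ... | false | _     = refl

  connected-elim : ∀ S → connectedᵇ Γ S ≡ true →
    ∀ u v → lookup S u ≡ true → lookup S v ≡ true → reach Γ S (order Γ) u v ≡ true
  connected-elim S e u v u∈S v∈S =
    subst (λ b → not b ∨ reach Γ S (order Γ) u v ≡ true) (cong₂ _∧_ u∈S v∈S)
      (all-elim _ (all-elim _ (∧-elimʳ (nonemptyᵇ S) e) u) v)

  ∅-disconnected : connectedᵇ Γ ∅ ≡ false
  ∅-disconnected with connectedᵇ Γ ∅ in e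
  ... | false = refl
  ... | true with any-elim {order Γ} (λ v → v ∈ᵇ ∅) (∧-elimˡ (nonemptyᵇ {order Γ} ∅) e)
  ... | v , v∈∅ = ⊥-elim (∉∅ v v∈∅)

  singleton-connected : ∀ v → connectedᵇ Γ (singleton v) ≡ true
  singleton-connected v = connected-intro (singleton v) (v , singleton-self v) walk
    where
    walk : ∀ u w → lookup (singleton v) u ≡ true → lookup (singleton v) w ≡ true →
      reach Γ (singleton v) (order Γ) u w ≡ true
    walk u w u∈ w∈ rewrite singleton-member v u u∈ | singleton-member v w w∈ = reach-self _ v

  -- Any set containing a universal vertex w is connected: u – w – v.
  universal-connected : ∀ S w → Universal w → lookup S w ≡ true → connectedᵇ Γ S ≡ true
  universal-connected S w univ w∈S = connected-intro S (w , w∈S) walk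
    where
    toward : ∀ u → ¬ w ≡ u → adj Γ u w ≡ true
    toward u w≢u = trans (Graph.sym Γ u w) (univ u w≢u)
    walk : ∀ u v → lookup S u ≡ true → lookup S v ≡ true → reach Γ S (order Γ) u v ≡ true
    walk u v u∈S v∈S with u ≟ v | w ≟ u | w ≟ v
    ... | yes refl | _        | _        = reach-self S u
    ... | no u≢v   | yes refl | _        = reach-edge S u v (univ v u≢v) v∈S
    ... | no u≢v   | no _     | yes refl = reach-edge S u v (toward u (λ e → u≢v (sym e))) v∈S
    ... | no u≢v   | no w≢u   | no w≢v   = reach-mono S (order Γ) u v (distinct⇒2≤ u v u≢v)
      (reach-step S 1 u w v (reach-step S 0 u u w (reach-refl S u) (toward u w≢u) w∈S) (univ v w≢v) v∈S)

  pairSet : Fin (order Γ) → Fin (order Γ) → VSet (order Γ)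
  pairSet a b = tabulate (λ w → ⌊ w ≟ a ⌋ ∨ ⌊ w ≟ b ⌋)

  pair-member : ∀ a b x → lookup (pairSet a b) x ≡ true → x ≡ a ⊎ x ≡ b
  pair-member a b x e with x ≟ a | x ≟ b | trans (sym (lookup∘tabulate (λ w → ⌊ w ≟ a ⌋ ∨ ⌊ w ≟ b ⌋) x)) e
  ... | yes x≡a | _       | _ = inj₁ x≡a
  ... | no _    | yes x≡b | _ = inj₂ x≡b

  pair-left : ∀ a b → lookup (pairSet a b) a ≡ true
  pair-left a b = trans (lookup∘tabulate (λ w → ⌊ w ≟ a ⌋ ∨ ⌊ w ≟ b ⌋) a) (∨-introˡ _ (⌊⌋-true (a ≟ a) refl))

  pair-right : ∀ a b → lookup (pairSet a b) b ≡ true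
  pair-right a b = trans (lookup∘tabulate (λ w → ⌊ w ≟ a ⌋ ∨ ⌊ w ≟ b ⌋) b) (∨-introʳ ⌊ b ≟ a ⌋ (⌊⌋-true (b ≟ b) refl))

  pair-stuck : ∀ a b → adj Γ a b ≡ false → ∀ k x → reach Γ (pairSet a b) k a x ≡ true → x ≡ a
  pair-stuck a b ab zero    x e = sym (⌊⌋-sound (a ≟ x) e)
  pair-stuck a b ab (suc k) x e with ∨-elim (reach Γ (pairSet a b) k a x) e
  ... | inj₁ r = pair-stuck a b ab k x r
  ... | inj₂ r with any-elim _ r
  ... | w , walk with pair-stuck a b ab k w (∧-elimˡ _ walk)
  ... | refl with pair-member a b x (∧-elimʳ _ (∧-elimʳ (reach Γ (pairSet a b) k a a) walk))
  ...   | inj₁ x≡a  = x≡a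
  ...   | inj₂ refl = ⊥-elim (false≢true (trans (sym ab) (∧-elimˡ _ (∧-elimʳ (reach Γ (pairSet a b) k a a) walk))))

  pair-disconnected : ∀ a b → ¬ a ≡ b → adj Γ a b ≡ false → connectedᵇ Γ (pairSet a b) ≡ false
  pair-disconnected a b a≢b ab with connectedᵇ Γ (pairSet a b) in e
  ... | false = refl
  ... | true  = ⊥-elim (a≢b (sym (pair-stuck a b ab (order Γ) b
                  (connected-elim (pairSet a b) e a b (pair-left a b) (pair-right a b)))))

-- The exact index of alliance k_S and the exponent n + k_S.

exponent : (Γ : Graph) → VSet (order Γ) → ℤ
exponent Γ S = + order Γ ℤ.+ kS Γ S

data MinOverResult {n} (S : VSet n) (f : Fin n → ℤ) (L : List (Fin n)) : Maybe ℤ → Set where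
  no-member : (∀ v → v ∈ L → lookup S v ≡ false) → MinOverResult S f L nothing
  attained  : ∀ v → lookup S v ≡ true → MinOverResult S f L (just (f v))

minOver-result : ∀ {n} (S : VSet n) (f : Fin n → ℤ) L → MinOverResult S f L (minOver S f L)
minOver-result S f [] = no-member (λ v ())
minOver-result S f (v ∷ vs) with v ∈ᵇ S in v∈S | minOver S f vs | minOver-result S f vs
... | false | nothing     | no-member h  = no-member λ { w (here refl) → v∈S ; w (there m) → h w m }
... | false | just .(f w) | attained w e = attained w e
... | true  | nothing     | no-member _  = attained v v∈S
... | true  | just .(f w) | attained w e with ℤ.⊓-sel (f v) (f w)
...   | inj₁ min≡fv = subst (λ z → MinOverResult S f (v ∷ vs) (just z)) (sym min≡fv) (attained v v∈S)
...   | inj₂ min≡fw = subst (λ z → MinOverResult S f (v ∷ vs) (just z)) (sym min≡fw) (attained w e)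

kS-cases : ∀ Γ S → (kS Γ S ≡ + 0 × (∀ v → lookup S v ≡ false))
                 ⊎ ∃ λ v → lookup S v ≡ true × kS Γ S ≡ margin Γ S v
kS-cases Γ S with minOver S (margin Γ S) (allFin (order Γ)) | minOver-result S (margin Γ S) (allFin (order Γ))
... | nothing | no-member h  = inj₁ (refl , λ v → h v (∈-allFin v))
... | just _  | attained v e = inj₂ (v , e , refl)

δ≤order : ∀ Γ X v → δ Γ X v ≤ order Γ
δ≤order Γ X v = ≤-trans (count-≤-length (λ w → adj Γ v w ∧ (w ∈ᵇ X)) (allFin (order Γ)))
                        (≤-reflexive (ListP.length-tabulate (λ x → x)))

shift-margin : ∀ n a b → b ≤ n → + n ℤ.+ (+ a - + b) ≡ + (n ∸ b + a)
shift-margin n a b b≤n = begin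
  + n ℤ.+ (+ a - + b)   ≡⟨ rearrange (+ n) (+ a) (+ b) ⟩
  (+ n - + b) ℤ.+ + a   ≡⟨ cong (ℤ._+ + a) (trans (ℤ.[+m]-[+n]≡m⊖n n b) (ℤ.≤-⊖ b≤n)) ⟩
  + (n ∸ b + a)         ∎
  where
  open ≡-Reasoning
  rearrange : ∀ x y z → x ℤ.+ (y - z) ≡ (x - z) ℤ.+ y
  rearrange = solve-∀

exponent-at : ∀ Γ S v → kS Γ S ≡ margin Γ S v →
  exponent Γ S ≡ + (order Γ ∸ δ Γ (complement S) v + δ Γ S v)
exponent-at Γ S v k≡ = trans (cong (ℤ._+_ (+ order Γ)) k≡)
  (shift-margin (order Γ) (δ Γ S v) (δ Γ (complement S) v) (δ≤order Γ (complement S) v))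

exponent-range : ∀ Γ S → ∃ λ m → m ≤ order Γ + order Γ × exponent Γ S ≡ + m
exponent-range Γ S with kS-cases Γ S
... | inj₁ (k≡0 , _) = order Γ + 0 , +-monoʳ-≤ (order Γ) z≤n , cong (ℤ._+_ (+ order Γ)) k≡0
... | inj₂ (v , _ , k≡) =
  order Γ ∸ δ Γ (complement S) v + δ Γ S v ,
  +-mono-≤ (m∸n≤m (order Γ) (δ Γ (complement S) v)) (δ≤order Γ S v) ,
  exponent-at Γ S v k≡

δ-compl : ∀ Γ X v →
  δ Γ X v + count (λ w → not (adj Γ v w ∧ (w ∈ᵇ X))) (allFin (order Γ)) ≡ order Γ
δ-compl Γ X v = trans (count-compl (λ w → adj Γ v w ∧ (w ∈ᵇ X)) (allFin (order Γ)))
                      (ListP.length-tabulate (λ x → x))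

-- A vertex with a non-neighbour x ≠ v has at most n − 2 neighbours in any X:
-- neither v itself nor x is counted.
missing-neighbour : ∀ Γ X v x → ¬ v ≡ x → adj Γ v x ≡ false → δ Γ X v + 2 ≤ order Γ
missing-neighbour Γ X v x v≢x vx =
  ≤-trans (+-monoʳ-≤ (δ Γ X v) uncounted) (≤-reflexive (δ-compl Γ X v))
  where
  uncounted : 2 ≤ count (λ w → not (adj Γ v w ∧ (w ∈ᵇ X))) (allFin (order Γ))
  uncounted = count-≥2 (λ w → not (adj Γ v w ∧ (w ∈ᵇ X))) (allFin (order Γ))
    (∈-allFin v) (∈-allFin x) v≢x
    (cong (λ b → not (b ∧ (v ∈ᵇ X))) (irrefl Γ v)) (cong (λ b → not (b ∧ (x ∈ᵇ X))) vx)

exponent-one : ∀ Γ S → exponent Γ S ≡ + 1 → order Γ ≡ 1 ⊎ ∃ (Universal Γ)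
exponent-one Γ S e with kS-cases Γ S
... | inj₁ (k≡0 , _) rewrite k≡0 = inj₁ (trans (sym (+-identityʳ _)) (ℤ.+-injective e))
... | inj₂ (v , _ , k≡) = inj₂ (v , universal)
  where
  n = order Γ
  b = δ Γ (complement S) v
  one : n ∸ b + δ Γ S v ≡ 1
  one = ℤ.+-injective (trans (sym (exponent-at Γ S v k≡)) e)
  universal : Universal Γ v
  universal x v≢x with adj Γ v x in vx
  ... | true  = refl
  ... | false = ⊥-elim (1+n≰n (begin
    2                 ≡⟨ m+n∸m≡n b 2 ⟨
    b + 2 ∸ b         ≤⟨ ∸-monoˡ-≤ b (missing-neighbour Γ (complement S) v x v≢x vx) ⟩
    n ∸ b             ≤⟨ m≤m+n (n ∸ b) (δ Γ S v) ⟩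
    n ∸ b + δ Γ S v   ≡⟨ one ⟩
    1                 ∎))
    where open ≤-Reasoning

singleton-inside : ∀ Γ w → δ Γ (singleton w) w ≡ 0
singleton-inside Γ w = count-none (λ x → adj Γ w x ∧ (x ∈ᵇ singleton w)) (allFin (order Γ)) no-loop
  where
  no-loop : ∀ x → adj Γ w x ∧ (x ∈ᵇ singleton w) ≡ false
  no-loop x with lookup (singleton w) x in x∈S
  ... | false = ∧-zeroʳ _
  ... | true rewrite singleton-member w x x∈S | irrefl Γ w = refl

-- A universal vertex w is adjacent to all n − 1 vertices outside {w}: the
-- only vertex not counted is w itself.
universal-outside : ∀ Γ w → Universal Γ w → δ Γ (complement (singleton w)) w + 1 ≡ order Γ
universal-outside Γ w univ =
  trans (cong (_+_ (δ Γ S̄ w)) (sym (≤-antisym at-most-w w-uncounted))) (δ-compl Γ S̄ w)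
  where
  S̄ = complement (singleton w)
  uncounted : Fin (order Γ) → Bool
  uncounted x = not (adj Γ w x ∧ (x ∈ᵇ S̄))
  only-w : ∀ x → uncounted x ≡ true → x ≡ w
  only-w x e with x ≟ w
  ... | yes x≡w = x≡w
  ... | no x≢w with lookup (singleton w) x in x∈S
  ...   | true  = singleton-member w x x∈S
  ...   | false = ⊥-elim (false≢true (trans (sym (cong not (∧-intro (univ x (λ w≡x → x≢w (sym w≡x)))
                    (trans (lookup-map x not (singleton w)) (cong not x∈S))))) e))
  at-most-w : count uncounted (allFin (order Γ)) ≤ 1
  at-most-w = count-allFin-≤1 uncounted (λ x y ex ey → trans (only-w x ex) (sym (only-w y ey)))
  w-uncounted : 1 ≤ count uncounted (allFin (order Γ))
  w-uncounted = count-≥1 uncounted (allFin (order Γ)) (∈-allFin w)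
                  (cong (λ c → not (c ∧ (w ∈ᵇ S̄))) (irrefl Γ w))

-- A universal vertex alone has exponent n − (n − 1) + 0 = 1.
universal-singleton : ∀ Γ w → Universal Γ w → exponent Γ (singleton w) ≡ + 1
universal-singleton Γ w univ with kS-cases Γ (singleton w)
... | inj₁ (_ , ∉S) = ⊥-elim (false≢true (trans (sym (∉S w)) (singleton-self w)))
... | inj₂ (v , v∈S , k≡) with singleton-member w v v∈S
... | refl = trans (exponent-at Γ (singleton w) w k≡) (cong +_ (begin
    n ∸ b + δ Γ (singleton w) w  ≡⟨ cong (_+_ (n ∸ b)) (singleton-inside Γ w) ⟩
    n ∸ b + 0                    ≡⟨ +-identityʳ (n ∸ b) ⟩
    n ∸ b                        ≡⟨ cong (_∸ b) (universal-outside Γ w univ) ⟨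
    b + 1 ∸ b                    ≡⟨ m+n∸m≡n b 1 ⟩
    1                            ∎))
  where
  open ≡-Reasoning
  n = order Γ
  b = δ Γ (complement (singleton w)) w

-- Evaluating A(Γ; x) at x = 1: the coefficients sum to the number of
-- connected vertex sets.

sumTo : ℕ → (ℕ → ℕ) → ℕ
sumTo zero    f = f 0
sumTo (suc N) f = sumTo N f + f (suc N)

sumTo-cong : ∀ N f g → (∀ j → f j ≡ g j) → sumTo N f ≡ sumTo N g
sumTo-cong zero    f g f≗g = f≗g 0
sumTo-cong (suc N) f g f≗g = cong₂ _+_ (sumTo-cong N f g f≗g) (f≗g (suc N))

sumTo-+ : ∀ N f g → sumTo N (λ j → f j + g j) ≡ sumTo N f + sumTo N g
sumTo-+ zero    f g = refl
sumTo-+ (suc N) f g = trans (cong (_+ (f (suc N) + g (suc N))) (sumTo-+ N f g))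
  (interchange +-commutativeSemigroup (sumTo N f) (sumTo N g) (f (suc N)) (g (suc N)))

sumTo-zero : ∀ N f → (∀ j → j ≤ N → f j ≡ 0) → sumTo N f ≡ 0
sumTo-zero zero    f h = h 0 z≤n
sumTo-zero (suc N) f h = cong₂ _+_ (sumTo-zero N f (λ j j≤N → h j (m≤n⇒m≤1+n j≤N))) (h (suc N) ≤-refl)

sumTo-delta : ∀ N m → m ≤ N → sumTo N (λ j → indicator ⌊ + m ℤ.≟ + j ⌋) ≡ 1
sumTo-delta zero    zero    z≤n  = cong indicator (⌊⌋-true (+ 0 ℤ.≟ + 0) refl)
sumTo-delta (suc N) m       m≤1+N with m ℕ.≟ suc N
... | yes refl = cong (_+ 1) (sumTo-zero N _ below)
  where
  below : ∀ j → j ≤ N → indicator ⌊ + suc N ℤ.≟ + j ⌋ ≡ 0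
  below j j≤N = cong indicator (⌊⌋-false (+ suc N ℤ.≟ + j)
                  (λ e → 1+n≰n (≤-trans (≤-reflexive (ℤ.+-injective e)) j≤N)))
... | no m≢1+N = trans (+-identityʳ _) (sumTo-delta N m (≤-pred (≤∧≢⇒< m≤1+N m≢1+N)))

count-by-value : ∀ {A : Set} (c : A → Bool) (e : A → ℤ) N L →
  (∀ x → ∃ λ m → m ≤ N × e x ≡ + m) →
  sumTo N (λ j → count (λ x → c x ∧ ⌊ e x ℤ.≟ + j ⌋) L) ≡ count c L
count-by-value c e N []      range = sumTo-zero N _ (λ _ _ → refl)
count-by-value c e N (x ∷ L) range = begin
  sumTo N (λ j → count (λ y → c y ∧ ⌊ e y ℤ.≟ + j ⌋) (x ∷ L))
    ≡⟨ sumTo-cong N _ _ (λ j → count-cons (λ y → c y ∧ ⌊ e y ℤ.≟ + j ⌋) x L) ⟩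
  sumTo N (λ j → indicator (c x ∧ ⌊ e x ℤ.≟ + j ⌋) + count (λ y → c y ∧ ⌊ e y ℤ.≟ + j ⌋) L)
    ≡⟨ sumTo-+ N _ _ ⟩
  sumTo N (λ j → indicator (c x ∧ ⌊ e x ℤ.≟ + j ⌋)) + sumTo N (λ j → count (λ y → c y ∧ ⌊ e y ℤ.≟ + j ⌋) L)
    ≡⟨ cong₂ _+_ (at-x (c x)) (count-by-value c e N L range) ⟩
  indicator (c x) + count c L
    ≡⟨ count-cons c x L ⟨
  count c (x ∷ L) ∎
  where
  open ≡-Reasoning
  at-x : ∀ b → sumTo N (λ j → indicator (b ∧ ⌊ e x ℤ.≟ + j ⌋)) ≡ indicator b
  at-x false = sumTo-zero N _ (λ _ _ → refl)
  at-x true with range x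
  ... | m , m≤N , ex rewrite ex = sumTo-delta N m m≤N

coefficient-witness : ∀ Γ j → 1 ≤ allianceCoeff Γ j → ∃ λ S → exponent Γ S ≡ j
coefficient-witness Γ j positive
  with count-witness (λ S → connectedᵇ Γ S ∧ ⌊ exponent Γ S ℤ.≟ j ⌋) (allSubsets (order Γ)) positive
... | S , counted = S , ⌊⌋-sound (exponent Γ S ℤ.≟ j) (∧-elimʳ (connectedᵇ Γ S) counted)

connectedCount : Graph → ℕ
connectedCount Γ = countSets (connectedᵇ Γ)

disconnectedCount : Graph → ℕ
disconnectedCount Γ = countSets (λ S → not (connectedᵇ Γ S))

connected+disconnected : ∀ Γ → connectedCount Γ + disconnectedCount Γ ≡ 2 ^ order Γ
connected+disconnected Γ = countSets-compl (connectedᵇ Γ)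

coefficient-sum : ∀ Γ N → order Γ + order Γ ≤ N → sumTo N (λ j → allianceCoeff Γ (+ j)) ≡ connectedCount Γ
coefficient-sum Γ N 2n≤N = count-by-value (connectedᵇ Γ) (exponent Γ) N (allSubsets (order Γ)) range
  where
  range : ∀ S → ∃ λ m → m ≤ N × exponent Γ S ≡ + m
  range S with exponent-range Γ S
  ... | m , m≤2n , e = m , ≤-trans m≤2n 2n≤N , e

same-connectedCount : ∀ Γ Δ → SameAlliancePoly Γ Δ → connectedCount Γ ≡ connectedCount Δ
same-connectedCount Γ Δ same = begin
  connectedCount Γ                          ≡⟨ coefficient-sum Γ N (m≤m+n _ _) ⟨
  sumTo N (λ j → allianceCoeff Γ (+ j))     ≡⟨ sumTo-cong N _ _ (λ j → same (+ j)) ⟩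
  sumTo N (λ j → allianceCoeff Δ (+ j))     ≡⟨ coefficient-sum Δ N (m≤n+m _ (order Γ + order Γ)) ⟩
  connectedCount Δ                          ∎
  where
  open ≡-Reasoning
  N = (order Γ + order Γ) + (order Δ + order Δ)

-- The graph K_t/e for t = t′ + 2: all pairs adjacent except {0, 1}.
Kₑ : ℕ → Graph
Kₑ t′ = Kminus (suc (suc t′)) (s≤s (s≤s z≤n))

Kₑ-universal : ∀ t′ (w : Fin t′) → Universal (Kₑ t′) (suc (suc w))
Kₑ-universal t′ w x w≢x rewrite ⌊⌋-false (suc (suc w) ≟ x) w≢x = refl

Kₑ-gap : ∀ t′ → VSet (suc (suc t′))
Kₑ-gap t′ = true ∷ true ∷ ∅

Kₑ-gap-disconnected : ∀ t′ → connectedᵇ (Kₑ t′) (Kₑ-gap t′) ≡ false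
Kₑ-gap-disconnected t′ = subst (λ S → connectedᵇ (Kₑ t′) S ≡ false) (sym gap≡pair)
  (pair-disconnected (Kₑ t′) zero (suc zero) (λ ()) refl)
  where
  pointwise : ∀ i → lookup (Kₑ-gap t′) i ≡ (⌊ i ≟ zero ⌋ ∨ ⌊ i ≟ suc zero ⌋)
  pointwise zero          = refl
  pointwise (suc zero)    = refl
  pointwise (suc (suc j)) = lookup-replicate j false
  gap≡pair : Kₑ-gap t′ ≡ pairSet (Kₑ t′) zero (suc zero)
  gap≡pair = trans (sym (tabulate∘lookup (Kₑ-gap t′))) (tabulate-cong pointwise)

-- Every set other than ∅ and {0, 1} is connected: it is a singleton inside
-- {0, 1} or contains a universal vertex.
Kₑ-connected : ∀ t′ S → (S =ˢ ∅) ≡ false → (S =ˢ Kₑ-gap t′) ≡ false → connectedᵇ (Kₑ t′) S ≡ true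
Kₑ-connected t′ (s₀ ∷ s₁ ∷ R) S≢∅ S≢gap with ≡-dec Bool._≟_ R ∅
... | no R≢∅ with nonempty-member R R≢∅
...   | i , i∈R = universal-connected (Kₑ t′) (s₀ ∷ s₁ ∷ R) (suc (suc i)) (Kₑ-universal t′ i) i∈R
Kₑ-connected t′ (true  ∷ false ∷ R) S≢∅ S≢gap | yes refl = singleton-connected (Kₑ t′) zero
Kₑ-connected t′ (false ∷ true  ∷ R) S≢∅ S≢gap | yes refl = singleton-connected (Kₑ t′) (suc zero)
Kₑ-connected t′ (false ∷ false ∷ R) S≢∅ S≢gap | yes refl = ⊥-elim (false≢true (trans (sym S≢∅) (=ˢ-refl {suc (suc t′)} ∅)))
Kₑ-connected t′ (true  ∷ true  ∷ R) S≢∅ S≢gap | yes refl =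
  ⊥-elim (false≢true (trans (sym S≢gap) (=ˢ-refl (Kₑ-gap t′))))

Kₑ-disconnectedCount : ∀ t′ → disconnectedCount (Kₑ t′) ≡ 2
Kₑ-disconnectedCount t′ =
  trans (countSets-remove P ∅ (cong not (∅-disconnected K)))
    (cong suc (trans (countSets-remove P′ (Kₑ-gap t′) (cong (λ c → not c ∧ true) (Kₑ-gap-disconnected t′)))
      (cong suc (countSets-none _ others))))
  where
  K = Kₑ t′
  P P′ : VSet (suc (suc t′)) → Bool
  P S  = not (connectedᵇ K S)
  P′ S = P S ∧ not (S =ˢ ∅)
  others : ∀ S → P′ S ∧ not (S =ˢ Kₑ-gap t′) ≡ false
  others S with S =ˢ Kₑ-gap t′ in S≟gap
  ... | true  = ∧-zeroʳ _
  ... | false with S =ˢ ∅ in S≟∅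
  ...   | true  = cong (_∧ true) (∧-zeroʳ (P S))
  ...   | false rewrite Kₑ-connected t′ S S≟∅ S≟gap = refl

Kₑ-connectedCount : ∀ t′ → connectedCount (Kₑ t′) + 2 ≡ 2 ^ suc (suc t′)
Kₑ-connectedCount t′ = trans (cong (_+_ (connectedCount (Kₑ t′))) (sym (Kₑ-disconnectedCount t′)))
                             (connected+disconnected (Kₑ t′))

-- For t ≥ 3 the singleton of the universal vertex 2 gives x¹ a positive coefficient.
Kₑ-coefficient-one : ∀ t″ → 1 ≤ allianceCoeff (Kₑ (suc t″)) (+ 1)
Kₑ-coefficient-one t″ = countSets-≥1 _ (singleton w)
  (∧-intro (singleton-connected K w)
           (⌊⌋-true (exponent K (singleton w) ℤ.≟ + 1) (universal-singleton K w (Kₑ-universal (suc t″) zero))))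
  where
  K = Kₑ (suc t″)
  w : Fin (order K)
  w = suc (suc zero)

-- Bounds on the order of a graph with C(Γ) = 2^t − 2.

^-cancel-< : ∀ {m k} → 2 ^ m < 2 ^ k → m < k
^-cancel-< {m} {k} 2^m<2^k with m ℕ.<? k
... | yes m<k = m<k
... | no  m≮k = ⊥-elim (<⇒≱ 2^m<2^k (^-monoʳ-≤ 2 (≮⇒≥ m≮k)))

-- t ≤ n: the empty set is not connected, so 2^t = C(Γ) + 2 ≤ 2^n + 1 < 2^(n+1).
order-lower : ∀ Γ t → connectedCount Γ + 2 ≡ 2 ^ t → t ≤ order Γ
order-lower Γ t C+2≡2^t = ≤-pred (^-cancel-< (begin-strict
  2 ^ t                  ≡⟨ C+2≡2^t ⟨
  C + 2                  ≤⟨ +-monoʳ-≤ C (s≤s D≥1) ⟩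
  C + suc D              ≡⟨ +-suc C D ⟩
  suc (C + D)            ≡⟨ cong suc (connected+disconnected Γ) ⟩
  suc (2 ^ n)            ≡⟨ +-comm 1 (2 ^ n) ⟩
  2 ^ n + 1              <⟨ +-monoʳ-< (2 ^ n) (≤-trans two≤2^n (≤-reflexive (sym (+-identityʳ (2 ^ n))))) ⟩
  2 ^ suc n              ∎))
  where
  open ≤-Reasoning
  n = order Γ
  C = connectedCount Γ
  D = disconnectedCount Γ
  D≥1 : 1 ≤ D
  D≥1 = countSets-≥1 (λ S → not (connectedᵇ Γ S)) ∅ (cong not (∅-disconnected Γ))
  two≤2^n : 2 ≤ 2 ^ n
  two≤2^n = ^-monoʳ-≤ 2 (nonempty Γ)

members-half : ∀ {n} (v : Fin n) (P : VSet n → Bool) → (∀ S → lookup S v ≡ true → P S ≡ true) →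
  2 ^ n ≤ countSets P + countSets P
members-half {suc m} v P v∈S⇒P = begin
  2 ^ suc m                  ≡⟨ cong (_+_ (2 ^ m)) (+-identityʳ (2 ^ m)) ⟩
  2 ^ m + 2 ^ m              ≡⟨ cong₂ _+_ (countSets-member v) (countSets-member v) ⟨
  Mᵥ + Mᵥ                    ≤⟨ +-mono-≤ Mᵥ≤P Mᵥ≤P ⟩
  countSets P + countSets P  ∎
  where
  open ≤-Reasoning
  Mᵥ = countSets (λ S → lookup S v)
  Mᵥ≤P : Mᵥ ≤ countSets P
  Mᵥ≤P = count-mono (λ S → lookup S v) P (allSubsets (suc m)) v∈S⇒P

-- n ≤ t in the presence of a universal vertex: the 2^(n−1) sets containing it
-- are connected, so 2^n ≤ 2·C(Γ) < 2^(t+1).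
order-upper-universal : ∀ Γ t w → Universal Γ w → connectedCount Γ + 2 ≡ 2 ^ t → order Γ ≤ t
order-upper-universal Γ t w univ C+2≡2^t = ≤-pred (^-cancel-< (begin-strict
  2 ^ order Γ                ≤⟨ members-half w (connectedᵇ Γ) (λ S → universal-connected Γ S w univ) ⟩
  C + C                      <⟨ +-mono-<-≤ (m<m+n C (s≤s z≤n)) (≤-trans (m≤m+n C 2) (≤-reflexive (sym (+-identityʳ (C + 2))))) ⟩
  (C + 2) + ((C + 2) + 0)    ≡⟨ cong (λ x → x + (x + 0)) C+2≡2^t ⟩
  2 ^ suc t                  ∎))
  where
  open ≤-Reasoning
  C = connectedCount Γ

order-upper-exponent-one : ∀ Γ t S → 1 ≤ t → exponent Γ S ≡ + 1 → connectedCount Γ + 2 ≡ 2 ^ t → order Γ ≤ t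
order-upper-exponent-one Γ t S 1≤t exponent≡1 C+2≡2^t with exponent-one Γ S exponent≡1
... | inj₁ n≡1          = ≤-trans (≤-reflexive n≡1) 1≤t
... | inj₂ (w , univ)   = order-upper-universal Γ t w univ C+2≡2^t

-- n ≤ 2 when C(Γ) = 2: every singleton is connected.
order-upper-two : ∀ Γ → connectedCount Γ ≡ 2 → order Γ ≤ 2
order-upper-two Γ C≡2 =
  ≤-trans (countSets-singletons (connectedᵇ Γ) (singleton-connected Γ)) (≤-reflexive C≡2)

same-as-Kₑ-connectedCount : ∀ t′ Γ → SameAlliancePoly Γ (Kₑ t′) → connectedCount Γ + 2 ≡ 2 ^ suc (suc t′)
same-as-Kₑ-connectedCount t′ Γ same =
  trans (cong (_+ 2) (same-connectedCount Γ (Kₑ t′) same)) (Kₑ-connectedCount t′)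

order-upper : ∀ t′ Γ → SameAlliancePoly Γ (Kₑ t′) → order Γ ≤ suc (suc t′)
order-upper zero Γ same = order-upper-two Γ
  (+-cancelʳ-≡ 2 (connectedCount Γ) 2 (same-as-Kₑ-connectedCount 0 Γ same))
order-upper (suc t″) Γ same =
  let S , exponent≡1 = coefficient-witness Γ (+ 1) (subst (1 ≤_) (sym (same (+ 1))) (Kₑ-coefficient-one t″))
  in order-upper-exponent-one Γ (3 + t″) S (s≤s z≤n) exponent≡1 (same-as-Kₑ-connectedCount (suc t″) Γ same)

-- Graphs with exactly two non-connected vertex sets.

record UniqueNonEdge (Γ : Graph) : Set where
  field
    a b  : Fin (order Γ)
    a≢b  : ¬ a ≡ b
    a≁b  : adj Γ a b ≡ false
    only : ∀ c d → ¬ c ≡ d → adj Γ c d ≡ false → (c ≡ a × d ≡ b) ⊎ (c ≡ b × d ≡ a)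

nonempty-≠∅ : ∀ {n} (S : VSet n) v → lookup S v ≡ true → (S =ˢ ∅) ≡ false
nonempty-≠∅ S v v∈S with S =ˢ ∅ in e
... | false = refl
... | true  = ⊥-elim (∉∅ v (subst (λ T → lookup T v ≡ true) (=ˢ-sound S ∅ e) v∈S))

complete-disconnectedCount : ∀ Γ → (∀ w → Universal Γ w) → disconnectedCount Γ ≡ 1
complete-disconnectedCount Γ complete =
  trans (countSets-remove P ∅ (cong not (∅-disconnected Γ))) (cong suc (countSets-none _ nonempty-connected))
  where
  P : VSet (order Γ) → Bool
  P S = not (connectedᵇ Γ S)
  nonempty-connected : ∀ S → P S ∧ not (S =ˢ ∅) ≡ false
  nonempty-connected S with S =ˢ ∅ in S≟∅
  ... | true  = ∧-zeroʳ _
  ... | false with nonempty-member S (λ S≡∅ → false≢true (trans (sym S≟∅) (trans (cong (_=ˢ ∅) S≡∅) (=ˢ-refl {order Γ} ∅))))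
  ...   | v , v∈S rewrite universal-connected Γ S v (complete v) v∈S = refl

-- If D(Γ) = 2 then Γ misses exactly one edge: a missing edge {a, b} exists
-- since otherwise D(Γ) = 1, and a second one {c, d} would add a third
-- non-connected set besides ∅ and {a, b}.
unique-nonedge : ∀ Γ → disconnectedCount Γ ≡ 2 → UniqueNonEdge Γ
unique-nonedge Γ D≡2 with any? (λ a → any? (λ b → ¬? (a ≟ b) ×-dec (adj Γ a b Bool.≟ false)))
... | no no-gap = ⊥-elim (1+n≰n (≤-reflexive (trans (sym D≡2) (complete-disconnectedCount Γ complete))))
  where
  complete : ∀ w → Universal Γ w
  complete w x w≢x with adj Γ w x in wx
  ... | true  = refl
  ... | false = ⊥-elim (no-gap (w , x , w≢x , wx))
... | yes (a , b , a≢b , a≁b) = record { a = a ; b = b ; a≢b = a≢b ; a≁b = a≁b ; only = only }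
  where
  P : VSet (order Γ) → Bool
  P S = not (connectedᵇ Γ S)
  pair-counted : ∀ c d → ¬ c ≡ d → adj Γ c d ≡ false → P (pairSet Γ c d) ≡ true
  pair-counted c d c≢d c≁d = cong not (pair-disconnected Γ c d c≢d c≁d)
  only : ∀ c d → ¬ c ≡ d → adj Γ c d ≡ false → (c ≡ a × d ≡ b) ⊎ (c ≡ b × d ≡ a)
  only c d c≢d c≁d with pairSet Γ c d =ˢ pairSet Γ a b in same-pair
  ... | true = match (pair-member Γ a b c (subst (λ T → lookup T c ≡ true) cd≡ab (pair-left Γ c d)))
                     (pair-member Γ a b d (subst (λ T → lookup T d ≡ true) cd≡ab (pair-right Γ c d)))
    where
    cd≡ab = =ˢ-sound (pairSet Γ c d) (pairSet Γ a b) same-pair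
    match : c ≡ a ⊎ c ≡ b → d ≡ a ⊎ d ≡ b → (c ≡ a × d ≡ b) ⊎ (c ≡ b × d ≡ a)
    match (inj₁ c≡a) (inj₁ d≡a) = ⊥-elim (c≢d (trans c≡a (sym d≡a)))
    match (inj₁ c≡a) (inj₂ d≡b) = inj₁ (c≡a , d≡b)
    match (inj₂ c≡b) (inj₁ d≡a) = inj₂ (c≡b , d≡a)
    match (inj₂ c≡b) (inj₂ d≡b) = ⊥-elim (c≢d (trans c≡b (sym d≡b)))
  ... | false = ⊥-elim (1+n≰n (≤-trans
          (countSets-≥3 P ∅ (pairSet Γ a b) (pairSet Γ c d)
             (cong not (∅-disconnected Γ)) (pair-counted a b a≢b a≁b) (pair-counted c d c≢d c≁d)
             (nonempty-≠∅ (pairSet Γ a b) a (pair-left Γ a b)) (nonempty-≠∅ (pairSet Γ c d) c (pair-left Γ c d)) same-pair)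
          (≤-reflexive D≡2)))

-- The isomorphism with K_n/e.

transpose-right : ∀ {n} (i j : Fin n) → PC.transpose i j j ≡ i
transpose-right i j with j ≟ i
... | yes j≡i = j≡i
... | no  _ rewrite dec-true (j ≟ j) refl = refl

transpose-other : ∀ {n} (i j k : Fin n) → ¬ k ≡ i → ¬ k ≡ j → PC.transpose i j k ≡ k
transpose-other i j k k≢i k≢j rewrite dec-false (k ≟ i) k≢i | dec-false (k ≟ j) k≢j = refl

-- Two distinct points can be moved to positions 0 and 1 by a permutation:
-- first swap a with 0, then swap the new position b′ of b with 1.
to-front : ∀ {n} (a b : Fin n) → ¬ a ≡ b →
  Σ (Permutation′ n) λ π → toℕ (π ⟨$⟩ʳ a) ≡ 0 × toℕ (π ⟨$⟩ʳ b) ≡ 1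
to-front {suc zero}    zero zero a≢b = ⊥-elim (a≢b refl)
to-front {suc (suc m)} a    b    a≢b =
  transpose zero a ∘ₚ transpose (suc zero) b′ , cong toℕ a↦0 , cong toℕ b↦1
  where
  b′ : Fin (suc (suc m))
  b′ = PC.transpose zero a b
  b′≢0 : ¬ b′ ≡ zero
  b′≢0 b′≡0 = a≢b (begin
    a                          ≡⟨ transpose-right a zero ⟨
    PC.transpose a zero zero   ≡⟨ cong (PC.transpose a zero) b′≡0 ⟨
    PC.transpose a zero b′     ≡⟨ PC.transpose-inverse a zero ⟩
    b                          ∎)
    where open ≡-Reasoning
  a↦0 : PC.transpose (suc zero) b′ (PC.transpose zero a a) ≡ zero
  a↦0 = trans (cong (PC.transpose (suc zero) b′) (transpose-right zero a))
              (transpose-other (suc zero) b′ zero (λ ()) (λ 0≡b′ → b′≢0 (sym 0≡b′)))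
  b↦1 : PC.transpose (suc zero) b′ b′ ≡ suc zero
  b↦1 = transpose-right (suc zero) b′

isE01-true : ∀ m k → isE01 m k ≡ true → (m ≡ 0 × k ≡ 1) ⊎ (m ≡ 1 × k ≡ 0)
isE01-true 0 1 e = inj₁ (refl , refl)
isE01-true 1 0 e = inj₂ (refl , refl)

-- A graph missing exactly the edge {a, b} is K_n/e: relabel a, b as 0, 1.
unique-nonedge⇒≅ : ∀ Γ (q : 2 ≤ order Γ) → UniqueNonEdge Γ → Γ ≅ Kminus (order Γ) q
unique-nonedge⇒≅ Γ q gap with to-front (UniqueNonEdge.a gap) (UniqueNonEdge.b gap) (UniqueNonEdge.a≢b gap)
... | π , a↦0 , b↦1 = ↔⇒⤖ π , preserves
  where
  open UniqueNonEdge gap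
  σ : Fin (order Γ) → Fin (order Γ)
  σ x = π ⟨$⟩ʳ x
  σ-injective : ∀ x y → σ x ≡ σ y → x ≡ y
  σ-injective x y σx≡σy = trans (sym (inverseˡ π)) (trans (cong (π ⟨$⟩ˡ_) σx≡σy) (inverseˡ π))
  at-0 : ∀ x → toℕ (σ x) ≡ 0 → x ≡ a
  at-0 x e = σ-injective x a (toℕ-injective (trans e (sym a↦0)))
  at-1 : ∀ x → toℕ (σ x) ≡ 1 → x ≡ b
  at-1 x e = σ-injective x b (toℕ-injective (trans e (sym b↦1)))
  gap-image : ∀ u v → ¬ u ≡ v → isE01 (toℕ (σ u)) (toℕ (σ v)) ≡ not (adj Γ u v)
  gap-image u v u≢v with adj Γ u v in u∼v
  ... | false with only u v u≢v u∼v
  ...   | inj₁ (refl , refl) rewrite a↦0 | b↦1 = refl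
  ...   | inj₂ (refl , refl) rewrite a↦0 | b↦1 = refl
  gap-image u v u≢v | true with isE01 (toℕ (σ u)) (toℕ (σ v)) in onto-gap
  ... | false = refl
  ... | true with isE01-true _ _ onto-gap
  ...   | inj₁ (u↦0 , v↦1) rewrite at-0 u u↦0 | at-1 v v↦1 = ⊥-elim (false≢true (trans (sym a≁b) u∼v))
  ...   | inj₂ (u↦1 , v↦0) rewrite at-1 u u↦1 | at-0 v v↦0 =
    ⊥-elim (false≢true (trans (sym a≁b) (trans (Graph.sym Γ a b) u∼v)))
  preserves : ∀ u v → adj (Kminus (order Γ) q) (σ u) (σ v) ≡ adj Γ u v
  preserves u v with u ≟ v
  ... | yes refl rewrite ⌊⌋-true (σ u ≟ σ u) refl | irrefl Γ u = refl
  ... | no u≢v rewrite ⌊⌋-false (σ u ≟ σ v) (λ e → u≢v (σ-injective u v e)) | gap-image u v u≢v =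
    not-involutive (adj Γ u v)

theorem3p12 : (t : ℕ) (2≤t : 2 ≤ t) (Γ : Graph) →
    SameAlliancePoly Γ (Kminus t 2≤t) → Γ ≅ Kminus t 2≤t
theorem3p12 (suc (suc t′)) (s≤s (s≤s z≤n)) Γ same =
  subst (λ m → (q : 2 ≤ m) → Γ ≅ Kminus m q) n≡t
    (λ q → unique-nonedge⇒≅ Γ q (unique-nonedge Γ D≡2)) (s≤s (s≤s z≤n))
  where
  C+2≡2^t : connectedCount Γ + 2 ≡ 2 ^ suc (suc t′)
  C+2≡2^t = same-as-Kₑ-connectedCount t′ Γ same
  n≡t : order Γ ≡ suc (suc t′)
  n≡t = ≤-antisym (order-upper t′ Γ same) (order-lower Γ (suc (suc t′)) C+2≡2^t)
  D≡2 : disconnectedCount Γ ≡ 2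
  D≡2 = +-cancelˡ-≡ (connectedCount Γ) (disconnectedCount Γ) 2
          (trans (connected+disconnected Γ) (trans (cong (2 ^_) n≡t) (sym C+2≡2^t)))
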